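{- Let $P_{(2,0)}$ be the set of all cylindric partitions with profile $c=(2,0)$. Then, as formal power series in $q$, $$\sum_{\Lambda\in P_{(2,0)}} q^{|\Lambda|}=\frac{(-q^2;q^2)_\infty}{(q;q)_\infty}.$$
   Context: Let $r,\ell$ be positive integers and $c=(c_1,\dots,c_r)$ a composition of $\ell$ into $r$ nonnegative integer parts (zero entries allowed). A cylindric partition with profile $c$ is a tuple $\Lambda=(\lambda^{(1)},\dots,\lambda^{(r)})$ of ordinary partitions $\lambda^{(i)}=(\lambda^{(i)}_1\ge\lambda^{(i)}_2\ge\cdots)$ (parts beyond the length are taken to be $0$) such that for all $i,j$: $\lambda^{(i)}_j\ge\lambda^{(i+1)}_{j+c_{i+1}}$ for $1\le i\le r-1$, and $\lambda^{(r)}_j\ge\lambda^{(1)}_{j+c_1}$. The size $|\Lambda|$ is the sum of all parts of all $\lambda^{(i)}$; the empty cylindric partition is included with size $0$. Notation: $(a;q)_n=\prod_{k=1}^n(1-aq^{k-1})$, $(a;q)_\infty=\lim_{n\to\infty}(a;q)_n$. -}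

module Defs where

open import Data.Nat as ℕ using (ℕ; zero; suc; _∸_; _≥_; _<_)
open import Data.Integer as ℤ using (ℤ; +_)
open import Data.Fin using (Fin; zero; suc; toℕ; fromℕ<)
open import Data.Vec using (Vec; lookup)
open import Data.List using (List; []; _∷_; map; upTo; zipWith; reverse)
import Data.List as L
open import Data.List.Relation.Unary.All using (All)
open import Data.List.Relation.Unary.Linked using (Linked)
open import Data.Product using (Σ; _×_)
open import Relation.Nullary using (yes; no)
open import Relation.Binary.PropositionalEquality using (_≡_)
open import Function.Bundles using (_↔_)

-- Ordinary partitions: weakly decreasing lists of positive parts.
-- Irrelevant proof fields, so equality of partitions is equality of parts.

record Partition : Set where
  constructor mkPartition
  field
    parts : List ℕ
    .decreasing : Linked _≥_ parts
    .positive   : All (0 <_) parts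
open Partition public

-- j-th part (0-indexed: part λ 0 = λ_1); parts beyond the length are 0.
part : Partition → ℕ → ℕ
part λ′ j = go (parts λ′) j
  where
  go : List ℕ → ℕ → ℕ
  go []       _       = 0
  go (x ∷ xs) zero    = x
  go (x ∷ xs) (suc j) = go xs j

∣_∣ₚ : Partition → ℕ
∣ λ′ ∣ₚ = L.foldr ℕ._+_ 0 (parts λ′)

next : ∀ {r} → Fin r → Fin r
next {suc r} i with toℕ i ℕ.<? r
... | yes p = suc (fromℕ< p)
... | no _  = zero

record CylindricPartition (r : ℕ) (c : Vec ℕ r) : Set where
  constructor mkCyl
  field
    comps : Vec Partition r
    -- λ^(i)_j ≥ λ^(i+1)_{j + c_{i+1}}  (indices cyclic, i = r wraps to 1)
    .cylindric : ∀ (i : Fin r) (j : ℕ) →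
      part (lookup comps i) j ≥ part (lookup comps (next i)) (j ℕ.+ lookup c (next i))
open CylindricPartition public

∣_∣ᶜ : ∀ {r c} → CylindricPartition r c → ℕ
∣ Λ ∣ᶜ = Data.Vec.foldr _ ℕ._+_ 0 (Data.Vec.map ∣_∣ₚ (comps Λ))
  where import Data.Vec

FPS : Set
FPS = ℕ → ℤ

𝟙 : FPS
𝟙 zero    = + 1
𝟙 (suc _) = + 0

mono : ℤ → ℕ → FPS
mono k e n with e ℕ.≟ n
... | yes _ = k
... | no _  = + 0

_⊕_ : FPS → FPS → FPS
(f ⊕ g) n = f n ℤ.+ g n

⊖_ : FPS → FPS
(⊖ f) n = ℤ.- f n

_⊗_ : FPS → FPS → FPS
(f ⊗ g) n = L.foldr ℤ._+_ (+ 0) (map (λ i → f i ℤ.* g (n ∸ i)) (upTo (suc n)))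

_^^_ : FPS → ℕ → FPS
f ^^ zero  = 𝟙
f ^^ suc k = f ⊗ (f ^^ k)

pochFin : FPS → FPS → ℕ → FPS
pochFin a b zero    = 𝟙
pochFin a b (suc k) = pochFin a b k ⊗ (𝟙 ⊕ (⊖ (a ⊗ (b ^^ k))))

-- infinite q-Pochhammer (a;b)_∞, for a, b with zero constant term:
-- the factor 1 - a b^k is 1 + O(q^{k+1}), so coefficient n is already
-- determined by the product of the first n+1 factors.
pochInf : FPS → FPS → FPS
pochInf a b n = pochFin a b (suc n) n

-- multiplicative inverse of a series with constant term 1:
-- g_0 = 1, g_m = - Σ_{i=1}^{m} f_i g_{m-i}
inv : FPS → FPS
inv f n = head (build (suc n))
  where
  -- build m = [g_{m-1}, …, g_0]
  build : ℕ → List ℤ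
  build zero    = []
  build (suc zero) = + 1 ∷ []
  build (suc (suc m)) =
    let gs = build (suc m) in
    ℤ.- L.foldr ℤ._+_ (+ 0)
          (zipWith ℤ._*_ (map (λ i → f (suc i)) (upTo (suc m))) gs) ∷ gs
  head : List ℤ → ℤ
  head []      = + 0
  head (x ∷ _) = x

-- f / g for g with constant term 1
_⊘_ : FPS → FPS → FPS
f ⊘ g = f ⊗ inv g

q : FPS
q = mono (+ 1) 1

-- "Σ_{Λ ∈ P_c} q^{|Λ|} = F" : for every n, the cylindric partitions of
-- profile c and size n are finite in number, that number being the
-- coefficient F n.

CylOfSize : (r : ℕ) → Vec ℕ r → ℕ → Set
CylOfSize r c n = Σ (CylindricPartition r c) (λ Λ → ∣ Λ ∣ᶜ ≡ n)

GenFunEq : (r : ℕ) → Vec ℕ r → FPS → Set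
GenFunEq r c F = ∀ (n : ℕ) → Σ ℕ (λ N → (F n ≡ + N) × (Fin N ↔ CylOfSize r c n))

module Submission where

open import Defs
open import Data.Vec using (_∷_; [])
open import Data.Integer using (ℤ; +_; -_)
open import Data.Nat as ℕ using (ℕ; zero; suc)
import Data.Nat.Properties as ℕ
open import Data.Fin using (Fin)
import Data.Fin as Fin
open import Data.Product using (_,_)
open import Function using (_∘_)
open import Function.Bundles using (_↔_; mk↔ₛ′)
open import Function.Properties.Inverse using (↔-sym; ↔-trans)
open import Relation.Binary.PropositionalEquality
open import Relation.Nullary.Decidable using (recompute)

-- A cylindric partition of profile (2,0) is a pair (λ¹, λ²) of partitions with λ²_j ≤ λ¹_j and
-- λ¹_{j+2} ≤ λ²_j; the heights (a, b) = (ℓ(λ¹), ℓ(λ²)) of its first column satisfy b ≤ a ≤ b + 2.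
-- Removing the first column maps the pairs with first column exactly (a, b) bijectively onto the
-- pairs with first column at most (a, b), lowering the size by a + b.  Splitting off in this way
-- the corners of the boxes "at most (m+1, m)" and "at most (m+1, m+1)" (or "at most (m+2, m)",
-- which has the same count), their generating functions O_m and D_m satisfy
--   O_0 = 1 / (1 - q),   D_m = O_m / (1 - q^(2m+2)),   O_(m+1) = (1 + q^(2m+2)) D_m / (1 - q^(2m+3)),
-- hence O_m · (q;q)_(2m+1) = (-q²;q²)_m.  Every pair of size n ≤ m lies in the box of O_m, so the
-- coefficients of O_m stabilise to those of (-q²;q²)_∞ / (q;q)_∞.

module PowerSeries where

  open import Data.Nat using (_∸_; _<_; z≤n; s≤s)
  open import Data.Integer using (_+_; _*_; 0ℤ; 1ℤ; -1ℤ)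
  import Data.Integer.Properties as ℤ
  open import Data.Integer.Tactic.RingSolver using (solve-∀)
  open import Data.List using (List; []; _∷_; foldr; map; zipWith; applyUpTo; upTo)
  open import Data.List.Properties using (map-applyUpTo)
  open import Function using (id)
  open import Relation.Nullary using (yes; no; contradiction)
  open import Relation.Binary.Bundles using (Setoid)
  open import Algebra.Bundles using (CommutativeMonoid)
  open import Algebra.Structures using (IsCommutativeMonoid)
  open import Level using (0ℓ)
  open ≡-Reasoning

  ∑ : ℕ → (ℕ → ℤ) → ℤ
  ∑ zero    f = 0ℤ
  ∑ (suc n) f = f 0 + ∑ n (f ∘ suc)

  infix 5 ∑
  syntax ∑ n (λ i → x) = ∑[ i < n ] x

  ∑-cong : ∀ n {f g : ℕ → ℤ} → (∀ {i} → i < n → f i ≡ g i) → ∑ n f ≡ ∑ n g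
  ∑-cong zero    f≡g = refl
  ∑-cong (suc n) f≡g = cong₂ _+_ (f≡g (s≤s z≤n)) (∑-cong n (f≡g ∘ s≤s))

  ∑-init-last : ∀ n (f : ℕ → ℤ) → ∑ (suc n) f ≡ ∑ n f + f n
  ∑-init-last zero    f = ℤ.+-comm (f 0) 0ℤ
  ∑-init-last (suc n) f = begin
    f 0 + ∑ (suc n) (f ∘ suc)         ≡⟨ cong (_+_ (f 0)) (∑-init-last n (f ∘ suc)) ⟩
    f 0 + (∑ n (f ∘ suc) + f (suc n)) ≡⟨ ℤ.+-assoc (f 0) _ _ ⟨
    f 0 + ∑ n (f ∘ suc) + f (suc n)   ∎

  ∑-reverse : ∀ n (f : ℕ → ℤ) → ∑[ i < suc n ] f i ≡ ∑[ i < suc n ] f (n ∸ i)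
  ∑-reverse zero    f = refl
  ∑-reverse (suc n) f = begin
    f 0 + (∑[ i < suc n ] f (suc i))
      ≡⟨ cong (_+_ (f 0)) (∑-reverse n (f ∘ suc)) ⟩
    f 0 + (∑[ i < suc n ] f (suc (n ∸ i)))
      ≡⟨ ℤ.+-comm (f 0) _ ⟩
    (∑[ i < suc n ] f (suc (n ∸ i))) + f 0
      ≡⟨ cong₂ _+_ (∑-cong (suc n) {λ i → f (suc n ∸ i)} λ i<1+n → cong f (ℕ.+-∸-assoc 1 (ℕ.≤-pred i<1+n)))
                   (cong f (ℕ.n∸n≡0 (suc n))) ⟨
    (∑[ i < suc n ] f (suc n ∸ i)) + f (suc n ∸ suc n)
      ≡⟨ ∑-init-last (suc n) (λ i → f (suc n ∸ i)) ⟨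
    (∑[ i < suc (suc n) ] f (suc n ∸ i))
      ∎

  foldr-applyUpTo : ∀ n (f : ℕ → ℤ) → foldr _+_ 0ℤ (applyUpTo f n) ≡ ∑ n f
  foldr-applyUpTo zero    f = refl
  foldr-applyUpTo (suc n) f = cong (_+_ (f 0)) (foldr-applyUpTo n (f ∘ suc))

  ⊗-∑ : ∀ f g n → (f ⊗ g) n ≡ ∑[ i < suc n ] f i * g (n ∸ i)
  ⊗-∑ f g n = trans (cong (foldr _+_ 0ℤ) (map-applyUpTo id h (suc n))) (foldr-applyUpTo (suc n) h)
    where h = λ i → f i * g (n ∸ i)

  ⊗-zero : ∀ f g → (f ⊗ g) 0 ≡ f 0 * g 0
  ⊗-zero f g = trans (⊗-∑ f g 0) (ℤ.+-identityʳ (f 0 * g 0))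

  ⊗-suc : ∀ f g n → (f ⊗ g) (suc n) ≡ f 0 * g (suc n) + ((f ∘ suc) ⊗ g) n
  ⊗-suc f g n = trans (⊗-∑ f g (suc n)) (cong (_+_ (f 0 * g (suc n))) (sym (⊗-∑ (f ∘ suc) g n)))

  ⊗-cong-≤ : ∀ n {f f′ g g′} → (∀ {i} → i ℕ.≤ n → f i ≡ f′ i) → (∀ {i} → i ℕ.≤ n → g i ≡ g′ i) →
             (f ⊗ g) n ≡ (f′ ⊗ g′) n
  ⊗-cong-≤ n {f} {f′} {g} {g′} f≡f′ g≡g′ = begin
    (f ⊗ g) n
      ≡⟨ ⊗-∑ f g n ⟩
    (∑[ i < suc n ] f i * g (n ∸ i))
      ≡⟨ ∑-cong (suc n) {λ i → f i * g (n ∸ i)} (λ {i} i<1+n →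
           cong₂ _*_ (f≡f′ (ℕ.≤-pred i<1+n)) (g≡g′ (ℕ.m∸n≤m n i))) ⟩
    (∑[ i < suc n ] f′ i * g′ (n ∸ i))
      ≡⟨ ⊗-∑ f′ g′ n ⟨
    (f′ ⊗ g′) n
      ∎

  ⊗-cong : ∀ {f f′ g g′} → f ≗ f′ → g ≗ g′ → f ⊗ g ≗ f′ ⊗ g′
  ⊗-cong f≗f′ g≗g′ n = ⊗-cong-≤ n (λ {i} _ → f≗f′ i) (λ {i} _ → g≗g′ i)

  ⊗-congˡ : ∀ h {f g} → f ≗ g → h ⊗ f ≗ h ⊗ g
  ⊗-congˡ h = ⊗-cong {f = h} (λ _ → refl)

  ⊗-congʳ : ∀ h {f g} → f ≗ g → f ⊗ h ≗ g ⊗ h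
  ⊗-congʳ h f≗g = ⊗-cong {g = h} f≗g (λ _ → refl)

  ⊗-comm : ∀ f g → f ⊗ g ≗ g ⊗ f
  ⊗-comm f g n = begin
    (f ⊗ g) n
      ≡⟨ ⊗-∑ f g n ⟩
    (∑[ i < suc n ] f i * g (n ∸ i))
      ≡⟨ ∑-reverse n (λ i → f i * g (n ∸ i)) ⟩
    (∑[ i < suc n ] f (n ∸ i) * g (n ∸ (n ∸ i)))
      ≡⟨ ∑-cong (suc n) {λ i → f (n ∸ i) * g (n ∸ (n ∸ i))} (λ {i} i<1+n →
           trans (ℤ.*-comm (f (n ∸ i)) _) (cong (λ j → g j * f (n ∸ i)) (ℕ.m∸[m∸n]≡n (ℕ.≤-pred i<1+n)))) ⟩
    (∑[ i < suc n ] g i * f (n ∸ i))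
      ≡⟨ ⊗-∑ g f n ⟨
    (g ⊗ f) n
      ∎

  ⊗-identityʳ : ∀ f → f ⊗ 𝟙 ≗ f
  ⊗-identityʳ f zero    = trans (⊗-zero f 𝟙) (ℤ.*-identityʳ (f 0))
  ⊗-identityʳ f (suc n) = begin
    (f ⊗ 𝟙) (suc n)              ≡⟨ ⊗-suc f 𝟙 n ⟩
    f 0 * 0ℤ + ((f ∘ suc) ⊗ 𝟙) n ≡⟨ cong₂ _+_ (ℤ.*-zeroʳ (f 0)) (⊗-identityʳ (f ∘ suc) n) ⟩
    0ℤ + f (suc n)               ≡⟨ ℤ.+-identityˡ _ ⟩
    f (suc n)                    ∎

  ⊗-identityˡ : ∀ f → 𝟙 ⊗ f ≗ f
  ⊗-identityˡ f n = trans (⊗-comm 𝟙 f n) (⊗-identityʳ f n)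

  _·_ : ℤ → FPS → FPS
  (c · f) n = c * f n

  ⊗-linearˡ : ∀ c f g h n → (((c · f) ⊕ g) ⊗ h) n ≡ c * (f ⊗ h) n + (g ⊗ h) n
  ⊗-linearˡ c f g h zero = begin
    (((c · f) ⊕ g) ⊗ h) 0       ≡⟨ ⊗-zero ((c · f) ⊕ g) h ⟩
    (c * f 0 + g 0) * h 0       ≡⟨ rearrange c (f 0) (g 0) (h 0) ⟩
    c * (f 0 * h 0) + g 0 * h 0 ≡⟨ cong₂ (λ x y → c * x + y) (⊗-zero f h) (⊗-zero g h) ⟨
    c * (f ⊗ h) 0 + (g ⊗ h) 0   ∎
    where
    rearrange : ∀ c a b d → (c * a + b) * d ≡ c * (a * d) + b * d
    rearrange = solve-∀
  ⊗-linearˡ c f g h (suc n) = begin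
    (((c · f) ⊕ g) ⊗ h) (suc n)
      ≡⟨ ⊗-suc ((c · f) ⊕ g) h n ⟩
    (c * f 0 + g 0) * h (suc n) + (((c · (f ∘ suc)) ⊕ (g ∘ suc)) ⊗ h) n
      ≡⟨ cong (_+_ ((c * f 0 + g 0) * h (suc n))) (⊗-linearˡ c (f ∘ suc) (g ∘ suc) h n) ⟩
    (c * f 0 + g 0) * h (suc n) + (c * ((f ∘ suc) ⊗ h) n + ((g ∘ suc) ⊗ h) n)
      ≡⟨ rearrange c (f 0) (g 0) (h (suc n)) _ _ ⟩
    c * (f 0 * h (suc n) + ((f ∘ suc) ⊗ h) n) + (g 0 * h (suc n) + ((g ∘ suc) ⊗ h) n)
      ≡⟨ cong₂ (λ x y → c * x + y) (⊗-suc f h n) (⊗-suc g h n) ⟨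
    c * (f ⊗ h) (suc n) + (g ⊗ h) (suc n)
      ∎
    where
    rearrange : ∀ c a b d x y → (c * a + b) * d + (c * x + y) ≡ c * (a * d + x) + (b * d + y)
    rearrange = solve-∀

  ⊗-assoc : ∀ f g h → (f ⊗ g) ⊗ h ≗ f ⊗ (g ⊗ h)
  ⊗-assoc f g h zero = begin
    ((f ⊗ g) ⊗ h) 0     ≡⟨ ⊗-zero (f ⊗ g) h ⟩
    (f ⊗ g) 0 * h 0     ≡⟨ cong (_* h 0) (⊗-zero f g) ⟩
    f 0 * g 0 * h 0     ≡⟨ ℤ.*-assoc (f 0) (g 0) (h 0) ⟩
    f 0 * (g 0 * h 0)   ≡⟨ cong (f 0 *_) (⊗-zero g h) ⟨
    f 0 * (g ⊗ h) 0     ≡⟨ ⊗-zero f (g ⊗ h) ⟨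
    (f ⊗ (g ⊗ h)) 0     ∎
  ⊗-assoc f g h (suc n) = begin
    ((f ⊗ g) ⊗ h) (suc n)
      ≡⟨ ⊗-suc (f ⊗ g) h n ⟩
    (f ⊗ g) 0 * h (suc n) + (((f ⊗ g) ∘ suc) ⊗ h) n
      ≡⟨ cong₂ (λ x y → x * h (suc n) + y) (⊗-zero f g) (⊗-congʳ h (⊗-suc f g) n) ⟩
    f 0 * g 0 * h (suc n) + (((f 0 · (g ∘ suc)) ⊕ ((f ∘ suc) ⊗ g)) ⊗ h) n
      ≡⟨ cong (_+_ (f 0 * g 0 * h (suc n))) (⊗-linearˡ (f 0) (g ∘ suc) ((f ∘ suc) ⊗ g) h n) ⟩
    f 0 * g 0 * h (suc n) + (f 0 * ((g ∘ suc) ⊗ h) n + (((f ∘ suc) ⊗ g) ⊗ h) n)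
      ≡⟨ cong (λ x → f 0 * g 0 * h (suc n) + (f 0 * ((g ∘ suc) ⊗ h) n + x)) (⊗-assoc (f ∘ suc) g h n) ⟩
    f 0 * g 0 * h (suc n) + (f 0 * ((g ∘ suc) ⊗ h) n + ((f ∘ suc) ⊗ (g ⊗ h)) n)
      ≡⟨ rearrange (f 0) (g 0) (h (suc n)) _ _ ⟩
    f 0 * (g 0 * h (suc n) + ((g ∘ suc) ⊗ h) n) + ((f ∘ suc) ⊗ (g ⊗ h)) n
      ≡⟨ cong (λ x → f 0 * x + ((f ∘ suc) ⊗ (g ⊗ h)) n) (⊗-suc g h n) ⟨
    f 0 * (g ⊗ h) (suc n) + ((f ∘ suc) ⊗ (g ⊗ h)) n
      ≡⟨ ⊗-suc f (g ⊗ h) n ⟨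
    (f ⊗ (g ⊗ h)) (suc n)
      ∎
    where
    rearrange : ∀ a b d x y → a * b * d + (a * x + y) ≡ a * (b * d + x) + y
    rearrange = solve-∀

  ⊗-distribˡ-⊕ : ∀ f g h → f ⊗ (g ⊕ h) ≗ (f ⊗ g) ⊕ (f ⊗ h)
  ⊗-distribˡ-⊕ f g h zero = begin
    (f ⊗ (g ⊕ h)) 0       ≡⟨ ⊗-zero f (g ⊕ h) ⟩
    f 0 * (g 0 + h 0)     ≡⟨ ℤ.*-distribˡ-+ (f 0) (g 0) (h 0) ⟩
    f 0 * g 0 + f 0 * h 0 ≡⟨ cong₂ _+_ (⊗-zero f g) (⊗-zero f h) ⟨
    (f ⊗ g) 0 + (f ⊗ h) 0 ∎
  ⊗-distribˡ-⊕ f g h (suc n) = begin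
    (f ⊗ (g ⊕ h)) (suc n)
      ≡⟨ ⊗-suc f (g ⊕ h) n ⟩
    f 0 * (g (suc n) + h (suc n)) + ((f ∘ suc) ⊗ (g ⊕ h)) n
      ≡⟨ cong (_+_ (f 0 * (g (suc n) + h (suc n)))) (⊗-distribˡ-⊕ (f ∘ suc) g h n) ⟩
    f 0 * (g (suc n) + h (suc n)) + (((f ∘ suc) ⊗ g) n + ((f ∘ suc) ⊗ h) n)
      ≡⟨ rearrange (f 0) (g (suc n)) (h (suc n)) _ _ ⟩
    (f 0 * g (suc n) + ((f ∘ suc) ⊗ g) n) + (f 0 * h (suc n) + ((f ∘ suc) ⊗ h) n)
      ≡⟨ cong₂ _+_ (⊗-suc f g n) (⊗-suc f h n) ⟨
    (f ⊗ g) (suc n) + (f ⊗ h) (suc n)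
      ∎
    where
    rearrange : ∀ a x y u v → a * (x + y) + (u + v) ≡ (a * x + u) + (a * y + v)
    rearrange = solve-∀

  ⊗-isCommutativeMonoid : IsCommutativeMonoid _≗_ _⊗_ 𝟙
  ⊗-isCommutativeMonoid = record
    { isMonoid = record
      { isSemigroup = record
        { isMagma = record
          { isEquivalence = Setoid.isEquivalence (ℕ →-setoid ℤ)
          ; ∙-cong        = ⊗-cong
          }
        ; assoc = ⊗-assoc
        }
      ; identity = ⊗-identityˡ , ⊗-identityʳ
      }
    ; comm = ⊗-comm
    }

  ⊗-commutativeMonoid : CommutativeMonoid 0ℓ 0ℓ
  ⊗-commutativeMonoid = record { isCommutativeMonoid = ⊗-isCommutativeMonoid }

  mono-≡ : ∀ c e → mono c e e ≡ c
  mono-≡ c e with e ℕ.≟ e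
  ... | yes _  = refl
  ... | no e≢e = contradiction refl e≢e

  mono-≢ : ∀ c e n → e ≢ n → mono c e n ≡ 0ℤ
  mono-≢ c e n e≢n with e ℕ.≟ n
  ... | yes e≡n = contradiction e≡n e≢n
  ... | no _    = refl

  mono-suc : ∀ c e n → mono c (suc e) (suc n) ≡ mono c e n
  mono-suc c e n with e ℕ.≟ n
  ... | yes refl = mono-≡ c (suc e)
  ... | no e≢n   = mono-≢ c (suc e) (suc n) (e≢n ∘ ℕ.suc-injective)

  mono-scale : ∀ a b e n → a * mono b e n ≡ mono (a * b) e n
  mono-scale a b e n with e ℕ.≟ n
  ... | yes _ = refl
  ... | no _  = ℤ.*-zeroʳ a

  ⊖-mono : ∀ c e → ⊖ mono c e ≗ mono (- c) e
  ⊖-mono c e n with e ℕ.≟ n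
  ... | yes _ = refl
  ... | no _  = refl

  𝟙≗mono : 𝟙 ≗ mono 1ℤ 0
  𝟙≗mono zero    = sym (mono-≡ 1ℤ 0)
  𝟙≗mono (suc n) = sym (mono-≢ 1ℤ 0 (suc n) λ ())

  ⊗-zeroˡ : ∀ f → (λ _ → 0ℤ) ⊗ f ≗ (λ _ → 0ℤ)
  ⊗-zeroˡ f zero    = ⊗-zero (λ _ → 0ℤ) f
  ⊗-zeroˡ f (suc n) = trans (⊗-suc (λ _ → 0ℤ) f n) (trans (ℤ.+-identityˡ _) (⊗-zeroˡ f n))

  mono-zero-⊗ : ∀ c f n → (mono c 0 ⊗ f) n ≡ c * f n
  mono-zero-⊗ c f zero    = trans (⊗-zero (mono c 0) f) (cong (_* f 0) (mono-≡ c 0))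
  mono-zero-⊗ c f (suc n) = begin
    (mono c 0 ⊗ f) (suc n)
      ≡⟨ ⊗-suc (mono c 0) f n ⟩
    mono c 0 0 * f (suc n) + ((mono c 0 ∘ suc) ⊗ f) n
      ≡⟨ cong₂ _+_ (cong (_* f (suc n)) (mono-≡ c 0)) (⊗-congʳ f (λ k → mono-≢ c 0 (suc k) λ ()) n) ⟩
    c * f (suc n) + ((λ _ → 0ℤ) ⊗ f) n
      ≡⟨ cong (_+_ (c * f (suc n))) (⊗-zeroˡ f n) ⟩
    c * f (suc n) + 0ℤ
      ≡⟨ ℤ.+-identityʳ _ ⟩
    c * f (suc n)
      ∎

  mono-suc-⊗-zero : ∀ c e f → (mono c (suc e) ⊗ f) 0 ≡ 0ℤ
  mono-suc-⊗-zero c e f = trans (⊗-zero (mono c (suc e)) f) (cong (_* f 0) (mono-≢ c (suc e) 0 λ ()))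

  mono-suc-⊗-suc : ∀ c e f n → (mono c (suc e) ⊗ f) (suc n) ≡ (mono c e ⊗ f) n
  mono-suc-⊗-suc c e f n = begin
    (mono c (suc e) ⊗ f) (suc n)
      ≡⟨ ⊗-suc (mono c (suc e)) f n ⟩
    mono c (suc e) 0 * f (suc n) + ((mono c (suc e) ∘ suc) ⊗ f) n
      ≡⟨ cong₂ _+_ (cong (_* f (suc n)) (mono-≢ c (suc e) 0 λ ())) (⊗-congʳ f (mono-suc c e) n) ⟩
    0ℤ + (mono c e ⊗ f) n
      ≡⟨ ℤ.+-identityˡ _ ⟩
    (mono c e ⊗ f) n
      ∎

  mono-⊗-mono : ∀ a b e k → mono a e ⊗ mono b k ≗ mono (a * b) (e ℕ.+ k)
  mono-⊗-mono a b zero    k n       = trans (mono-zero-⊗ a (mono b k) n) (mono-scale a b k n)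
  mono-⊗-mono a b (suc e) k zero    = trans (mono-suc-⊗-zero a e (mono b k)) (sym (mono-≢ (a * b) (suc e ℕ.+ k) 0 λ ()))
  mono-⊗-mono a b (suc e) k (suc n) = begin
    (mono a (suc e) ⊗ mono b k) (suc n) ≡⟨ mono-suc-⊗-suc a e (mono b k) n ⟩
    (mono a e ⊗ mono b k) n             ≡⟨ mono-⊗-mono a b e k n ⟩
    mono (a * b) (e ℕ.+ k) n            ≡⟨ mono-suc (a * b) (e ℕ.+ k) n ⟨
    mono (a * b) (suc e ℕ.+ k) (suc n)  ∎

  mono-⊗-< : ∀ c e f {n} → n < e → (mono c e ⊗ f) n ≡ 0ℤ
  mono-⊗-< c (suc e) f {zero}  _         = mono-suc-⊗-zero c e f
  mono-⊗-< c (suc e) f {suc n} (s≤s n<e) = trans (mono-suc-⊗-suc c e f n) (mono-⊗-< c e f n<e)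

  -- `inv` is defined through a list builder local to Defs, which cannot be named; unifying the
  -- metavariable `invBuild` with it in `inv-suc-invBuild` names it.  Abstracting `fs` there makes
  -- `zipWith` stuck on a variable, so that the unifier compares its arguments.
  mutual
    invBuild : FPS → ℕ → List ℤ
    invBuild = _

    inv-suc-invBuild : ∀ f m →
      inv f (suc m) ≡ - foldr _+_ 0ℤ (zipWith _*_ (map (f ∘ suc) (upTo (suc m))) (invBuild f m))
    inv-suc-invBuild f m with map (f ∘ suc) (upTo (suc m))
    ... | fs = refl

  invBuild-coefficients : ∀ f j → invBuild f j ≡ map (λ i → inv f (j ∸ i)) (upTo (suc j))
  invBuild-coefficients f zero    = refl
  invBuild-coefficients f (suc j) = cong₂ _∷_ (sym (inv-suc-invBuild f j)) (begin
    invBuild f j                                          ≡⟨ invBuild-coefficients f j ⟩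
    map (λ i → inv f (j ∸ i)) (upTo (suc j))              ≡⟨ map-applyUpTo id _ (suc j) ⟩
    applyUpTo (λ i → inv f (j ∸ i)) (suc j)               ≡⟨ map-applyUpTo suc _ (suc j) ⟨
    map (λ i → inv f (suc j ∸ i)) (applyUpTo suc (suc j)) ∎)

  zipWith-*-map : ∀ (g h : ℕ → ℤ) xs → zipWith _*_ (map g xs) (map h xs) ≡ map (λ i → g i * h i) xs
  zipWith-*-map g h []       = refl
  zipWith-*-map g h (x ∷ xs) = cong (g x * h x ∷_) (zipWith-*-map g h xs)

  inv-suc : ∀ f m → inv f (suc m) ≡ - ((f ∘ suc) ⊗ inv f) m
  inv-suc f m = begin
    inv f (suc m)
      ≡⟨ inv-suc-invBuild f m ⟩
    - foldr _+_ 0ℤ (zipWith _*_ fs (invBuild f m))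
      ≡⟨ cong (λ gs → - foldr _+_ 0ℤ (zipWith _*_ fs gs)) (invBuild-coefficients f m) ⟩
    - foldr _+_ 0ℤ (zipWith _*_ fs (map (λ i → inv f (m ∸ i)) (upTo (suc m))))
      ≡⟨ cong (λ xs → - foldr _+_ 0ℤ xs) (zipWith-*-map (f ∘ suc) (λ i → inv f (m ∸ i)) (upTo (suc m))) ⟩
    - ((f ∘ suc) ⊗ inv f) m
      ∎
    where fs = map (f ∘ suc) (upTo (suc m))

  ⊗-inverseʳ : ∀ f → f 0 ≡ 1ℤ → f ⊗ inv f ≗ 𝟙
  ⊗-inverseʳ f f₀≡1 zero    = trans (⊗-zero f (inv f)) (cong (_* 1ℤ) f₀≡1)
  ⊗-inverseʳ f f₀≡1 (suc m) = begin
    (f ⊗ inv f) (suc m)    ≡⟨ ⊗-suc f (inv f) m ⟩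
    f 0 * inv f (suc m) + x ≡⟨ cong₂ (λ a b → a * b + x) f₀≡1 (inv-suc f m) ⟩
    1ℤ * - x + x           ≡⟨ cong (_+ x) (ℤ.*-identityˡ (- x)) ⟩
    - x + x                ≡⟨ ℤ.+-inverseˡ x ⟩
    0ℤ                     ∎
    where x = ((f ∘ suc) ⊗ inv f) m

  ⊗-𝟙⊕mono : ∀ f c e n → (f ⊗ (𝟙 ⊕ mono c e)) n ≡ f n + (mono c e ⊗ f) n
  ⊗-𝟙⊕mono f c e n = trans (⊗-distribˡ-⊕ f 𝟙 (mono c e) n) (cong₂ _+_ (⊗-identityʳ f n) (⊗-comm f (mono c e) n))

  ⊗-𝟙⊕mono-< : ∀ f c {e n} → n < e → (f ⊗ (𝟙 ⊕ mono c e)) n ≡ f n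
  ⊗-𝟙⊕mono-< f c {e} {n} n<e =
    trans (⊗-𝟙⊕mono f c e n) (trans (cong (_+_ (f n)) (mono-⊗-< c e f n<e)) (ℤ.+-identityʳ (f n)))

  shift : ℕ → (ℕ → ℕ) → ℕ → ℕ
  shift zero    c n       = c n
  shift (suc e) c zero    = 0
  shift (suc e) c (suc n) = shift e c n

  shift-≥ : ∀ {e n} c → e ℕ.≤ n → shift e c n ≡ c (n ∸ e)
  shift-≥ {zero}          c _         = refl
  shift-≥ {suc e} {suc n} c (s≤s e≤n) = shift-≥ c e≤n

  shift-< : ∀ {e n} c → n < e → shift e c n ≡ 0
  shift-< {suc e} {zero}  c _         = refl
  shift-< {suc e} {suc n} c (s≤s n<e) = shift-< c n<e

  mono-⊗-shift : ∀ c e h n → (mono c e ⊗ (+_ ∘ h)) n ≡ c * + shift e h n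
  mono-⊗-shift c zero    h n       = mono-zero-⊗ c (+_ ∘ h) n
  mono-⊗-shift c (suc e) h zero    = trans (mono-suc-⊗-zero c e (+_ ∘ h)) (sym (ℤ.*-zeroʳ c))
  mono-⊗-shift c (suc e) h (suc n) = trans (mono-suc-⊗-suc c e (+_ ∘ h) n) (mono-⊗-shift c e h n)

  infix 30 1-q^_ 1+q^_
  1-q^_ 1+q^_ : ℕ → FPS
  1-q^ e = 𝟙 ⊕ mono -1ℤ e
  1+q^ e = 𝟙 ⊕ mono 1ℤ e

  q^^-mono : ∀ k → q ^^ k ≗ mono 1ℤ k
  q^^-mono zero      = 𝟙≗mono
  q^^-mono (suc k) n = trans (⊗-congˡ q (q^^-mono k) n) (mono-⊗-mono 1ℤ 1ℤ 1 k n)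

  q²^^-mono : ∀ k → (q ^^ 2) ^^ k ≗ mono 1ℤ (k ℕ.* 2)
  q²^^-mono zero      = 𝟙≗mono
  q²^^-mono (suc k) n = trans (⊗-cong (q^^-mono 2) (q²^^-mono k) n) (mono-⊗-mono 1ℤ 1ℤ 2 (k ℕ.* 2) n)

  poch-q poch-q² : ℕ → FPS
  poch-q  = pochFin q q
  poch-q² = pochFin (⊖ (q ^^ 2)) (q ^^ 2)

  poch-q-suc : ∀ k → poch-q (suc k) ≗ poch-q k ⊗ 1-q^ (suc k)
  poch-q-suc k = ⊗-congˡ (poch-q k) factor
    where
    factor : 𝟙 ⊕ (⊖ (q ⊗ (q ^^ k))) ≗ 1-q^ (suc k)
    factor n = cong (_+_ (𝟙 n)) (trans (cong -_ (q^^-mono (suc k) n)) (⊖-mono 1ℤ (suc k) n))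

  poch-q²-suc : ∀ k → poch-q² (suc k) ≗ poch-q² k ⊗ 1+q^ (2 ℕ.+ k ℕ.* 2)
  poch-q²-suc k = ⊗-congˡ (poch-q² k) factor
    where
    -q² : ⊖ (q ^^ 2) ≗ mono -1ℤ 2
    -q² n = trans (cong -_ (q^^-mono 2 n)) (⊖-mono 1ℤ 2 n)
    -q²⊗q²^^k : (⊖ (q ^^ 2)) ⊗ ((q ^^ 2) ^^ k) ≗ mono -1ℤ (2 ℕ.+ k ℕ.* 2)
    -q²⊗q²^^k n = trans (⊗-cong -q² (q²^^-mono k) n) (mono-⊗-mono -1ℤ 1ℤ 2 (k ℕ.* 2) n)
    factor : 𝟙 ⊕ (⊖ ((⊖ (q ^^ 2)) ⊗ ((q ^^ 2) ^^ k))) ≗ 1+q^ (2 ℕ.+ k ℕ.* 2)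
    factor n = cong (_+_ (𝟙 n)) (trans (cong -_ (-q²⊗q²^^k n)) (⊖-mono -1ℤ (2 ℕ.+ k ℕ.* 2) n))

  poch-q-stable : ∀ {j k} → suc j ℕ.≤′ k → poch-q k j ≡ pochInf q q j
  poch-q-stable ℕ.≤′-refl = refl
  poch-q-stable {j} (ℕ.≤′-step {k} 1+j≤′k) = begin
    poch-q (suc k) j          ≡⟨ poch-q-suc k j ⟩
    (poch-q k ⊗ 1-q^ suc k) j ≡⟨ ⊗-𝟙⊕mono-< (poch-q k) -1ℤ (ℕ.≤′⇒≤ (ℕ.≤′-step 1+j≤′k)) ⟩
    poch-q k j                ≡⟨ poch-q-stable 1+j≤′k ⟩
    pochInf q q j             ∎

  pochInf-q²-stable : ∀ n → pochInf (⊖ (q ^^ 2)) (q ^^ 2) n ≡ poch-q² n n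
  pochInf-q²-stable n = begin
    poch-q² (suc n) n                    ≡⟨ poch-q²-suc n n ⟩
    (poch-q² n ⊗ 1+q^ (2 ℕ.+ n ℕ.* 2)) n ≡⟨ ⊗-𝟙⊕mono-< (poch-q² n) 1ℤ (s≤s (ℕ.m≤n⇒m≤1+n (ℕ.m≤m*n n 2))) ⟩
    poch-q² n n                          ∎

module BoxCounts where

  open PowerSeries
  open import Data.Integer using (_+_; _*_; 1ℤ; -1ℤ)
  import Data.Integer.Properties as ℤ
  open import Data.Integer.Tactic.RingSolver using (solve-∀)
  open import Algebra.Solver.CommutativeMonoid ⊗-commutativeMonoid using (solve; _⊜_) renaming (_⊕_ to _⊛_)

  -- The coefficients of g / (1 - q^(1+u)); `lagged d n` is the coefficient of index n - (1+d),
  -- which keeps the recursion structural.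
  module _ (u : ℕ) (g : ℕ → ℕ) where
    mutual
      geometric : ℕ → ℕ
      geometric n = g n ℕ.+ lagged u n

      private
        lagged : ℕ → ℕ → ℕ
        lagged d       zero    = 0
        lagged zero    (suc n) = geometric n
        lagged (suc d) (suc n) = lagged d n

    geometric-unfold : ∀ n → geometric n ≡ g n ℕ.+ shift (suc u) geometric n
    geometric-unfold n = cong (g n ℕ.+_) (lagged≗shift u n)
      where
      lagged≗shift : ∀ d → lagged d ≗ shift (suc d) geometric
      lagged≗shift d       zero    = refl
      lagged≗shift zero    (suc n) = refl
      lagged≗shift (suc d) (suc n) = lagged≗shift d n

  geometric-⊗ : ∀ u g → (+_ ∘ geometric u g) ⊗ 1-q^ (suc u) ≗ +_ ∘ g
  geometric-⊗ u g n = begin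
    ((+_ ∘ G) ⊗ 1-q^ (suc u)) n             ≡⟨ ⊗-𝟙⊕mono (+_ ∘ G) -1ℤ (suc u) n ⟩
    + G n + (mono -1ℤ (suc u) ⊗ (+_ ∘ G)) n ≡⟨ cong (_+_ (+ G n)) (mono-⊗-shift -1ℤ (suc u) G n) ⟩
    + G n + -1ℤ * + s                       ≡⟨ cong (λ k → + k + -1ℤ * + s) (geometric-unfold u g n) ⟩
    + (g n ℕ.+ s) + -1ℤ * + s               ≡⟨ cong₂ _+_ (ℤ.pos-+ (g n) s) (ℤ.-1*i≡-i (+ s)) ⟩
    + g n + + s + - + s                     ≡⟨ cancel (+ g n) (+ s) ⟩
    + g n                                   ∎
    where
    open ≡-Reasoning
    G = geometric u g
    s = shift (suc u) G n
    cancel : ∀ x y → x + y + - y ≡ x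
    cancel = solve-∀

  ⊗-1+q^ : ∀ e h → (+_ ∘ h) ⊗ 1+q^ e ≗ (λ n → + (h n ℕ.+ shift e h n))
  ⊗-1+q^ e h n = begin
    ((+_ ∘ h) ⊗ 1+q^ e) n            ≡⟨ ⊗-𝟙⊕mono (+_ ∘ h) 1ℤ e n ⟩
    + h n + (mono 1ℤ e ⊗ (+_ ∘ h)) n ≡⟨ cong (_+_ (+ h n)) (mono-⊗-shift 1ℤ e h n) ⟩
    + h n + 1ℤ * + shift e h n       ≡⟨ cong (_+_ (+ h n)) (ℤ.*-identityˡ (+ shift e h n)) ⟩
    + h n + + shift e h n            ≡⟨ ℤ.pos-+ (h n) (shift e h n) ⟨
    + (h n ℕ.+ shift e h n)          ∎
    where open ≡-Reasoning

  emptyCount : ℕ → ℕ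
  emptyCount zero    = 1
  emptyCount (suc _) = 0

  -- The coefficients of O_m and D_m: boxCount m and squareCount m count the pairs with first
  -- column at most (m+1, m), resp. at most (m+1, m+1) or (m+2, m).
  mutual
    boxCount : ℕ → ℕ → ℕ
    boxCount zero    = geometric 0 emptyCount
    boxCount (suc m) = geometric (2 ℕ.+ m ℕ.* 2) (λ n → squareCount m n ℕ.+ shift (2 ℕ.+ m ℕ.* 2) (squareCount m) n)

    squareCount : ℕ → ℕ → ℕ
    squareCount m = geometric (1 ℕ.+ m ℕ.* 2) (boxCount m)

  boxCount-⊗-poch-q : ∀ m → (+_ ∘ boxCount m) ⊗ poch-q (suc (m ℕ.* 2)) ≗ poch-q² m
  boxCount-⊗-poch-q zero = begin
    B ⊗ poch-q 1          ≈⟨ ⊗-congˡ B (λ n → trans (poch-q-suc 0 n) (⊗-identityˡ (1-q^ 1) n)) ⟩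
    B ⊗ 1-q^ 1            ≈⟨ geometric-⊗ 0 emptyCount ⟩
    +_ ∘ emptyCount       ≈⟨ (λ { zero → refl ; (suc _) → refl }) ⟩
    𝟙                     ∎
    where
    open import Relation.Binary.Reasoning.Setoid (ℕ →-setoid ℤ)
    B = +_ ∘ boxCount 0
  boxCount-⊗-poch-q (suc m) = begin
    B ⊗ poch-q (suc e)
      ≈⟨ ⊗-congˡ B (λ n → trans (poch-q-suc e n) (⊗-congʳ (1-q^ suc e) (poch-q-suc (suc (m ℕ.* 2))) n)) ⟩
    B ⊗ ((Q ⊗ 1-q^ e) ⊗ 1-q^ (suc e))
      ≈⟨ solve 4 (λ b q x y → b ⊛ ((q ⊛ x) ⊛ y) ⊜ (b ⊛ y) ⊛ (q ⊛ x)) (λ _ → refl) B Q (1-q^ e) (1-q^ (suc e)) ⟩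
    (B ⊗ 1-q^ (suc e)) ⊗ (Q ⊗ 1-q^ e)
      ≈⟨ ⊗-congʳ (Q ⊗ 1-q^ e) (geometric-⊗ e g) ⟩
    (+_ ∘ g) ⊗ (Q ⊗ 1-q^ e)
      ≈⟨ ⊗-congʳ (Q ⊗ 1-q^ e) (⊗-1+q^ e (squareCount m)) ⟨
    (S ⊗ 1+q^ e) ⊗ (Q ⊗ 1-q^ e)
      ≈⟨ solve 4 (λ s q x y → (s ⊛ y) ⊛ (q ⊛ x) ⊜ ((s ⊛ x) ⊛ q) ⊛ y) (λ _ → refl) S Q (1-q^ e) (1+q^ e) ⟩
    ((S ⊗ 1-q^ e) ⊗ Q) ⊗ 1+q^ e
      ≈⟨ ⊗-congʳ (1+q^ e) (⊗-congʳ Q (geometric-⊗ (suc (m ℕ.* 2)) (boxCount m))) ⟩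
    ((+_ ∘ boxCount m) ⊗ Q) ⊗ 1+q^ e
      ≈⟨ ⊗-congʳ (1+q^ e) (boxCount-⊗-poch-q m) ⟩
    poch-q² m ⊗ 1+q^ e
      ≈⟨ poch-q²-suc m ⟨
    poch-q² (suc m)
      ∎
    where
    open import Relation.Binary.Reasoning.Setoid (ℕ →-setoid ℤ)
    e = 2 ℕ.+ m ℕ.* 2
    g = λ n → squareCount m n ℕ.+ shift e (squareCount m) n
    B = +_ ∘ boxCount (suc m)
    S = +_ ∘ squareCount m
    Q = poch-q (suc (m ℕ.* 2))

module Columns where

  open import Data.Nat using (_+_; _∸_; _≤_; _<_; _≥_; z≤n; s≤s)
  open import Data.List using (List; []; _∷_; length)
  open import Data.Nat.ListAction using (sum)
  open import Data.List.Relation.Unary.All using (All; []; _∷_)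
  open import Data.List.Relation.Unary.Linked as Linked using (Linked; []; [-]; _∷_)

  Decreasing Positive : List ℕ → Set
  Decreasing = Linked _≥_
  Positive   = All (0 <_)

  entry : List ℕ → ℕ → ℕ
  entry []       _       = 0
  entry (x ∷ xs) zero    = x
  entry (x ∷ xs) (suc j) = entry xs j

  -- `part` unfolds to a function local to Defs, which cannot be named; once `suc k` is abstracted,
  -- the `refl` below unifies the metavariable `partLocal` with it.
  mutual
    partLocal : Partition → ℕ → List ℕ → ℕ → ℕ
    partLocal p j = _

    part≡entry : ∀ p j → part p j ≡ entry (parts p) j
    part≡entry p j with parts p
    part≡entry p j       | []     = refl
    part≡entry p zero    | x ∷ xs = refl
    part≡entry p (suc k) | x ∷ xs with suc k
    ... | j = trans (refl {x = partLocal p j xs k}) (partLocal≗entry p j xs k)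

    partLocal≗entry : ∀ p j xs k → partLocal p j xs k ≡ entry xs k
    partLocal≗entry p j []       k       = refl
    partLocal≗entry p j (x ∷ xs) zero    = refl
    partLocal≗entry p j (x ∷ xs) (suc k) = partLocal≗entry p j xs k

  entry-≥length : ∀ xs {j} → length xs ≤ j → entry xs j ≡ 0
  entry-≥length []       _           = refl
  entry-≥length (x ∷ xs) (s≤s len≤j) = entry-≥length xs len≤j

  entry-<length : ∀ {xs} → Positive xs → ∀ {j} → j < length xs → 0 < entry xs j
  entry-<length (x>0 ∷ _)  {zero}  _         = x>0
  entry-<length (_ ∷ xs>0) {suc j} (s≤s j<n) = entry-<length xs>0 j<n

  entry≤head : ∀ {x xs} → Decreasing (x ∷ xs) → ∀ j → entry xs j ≤ x
  entry≤head [-]         j       = z≤n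
  entry≤head (y≤x ∷ _)   zero    = y≤x
  entry≤head (y≤x ∷ dec) (suc j) = ℕ.≤-trans (entry≤head dec j) y≤x

  length≤sum : ∀ {xs} → Positive xs → length xs ≤ sum xs
  length≤sum []           = z≤n
  length≤sum (x>0 ∷ xs>0) = ℕ.+-mono-≤ x>0 (length≤sum xs>0)

  removeColumn : List ℕ → List ℕ
  removeColumn (suc (suc x) ∷ xs) = suc x ∷ removeColumn xs
  removeColumn _                  = []

  addColumn : ℕ → List ℕ → List ℕ
  addColumn zero    _        = []
  addColumn (suc a) []       = 1 ∷ addColumn a []
  addColumn (suc a) (x ∷ xs) = suc x ∷ addColumn a xs

  entry-removeColumn : ∀ {xs} → Decreasing xs → ∀ j → entry (removeColumn xs) j ≡ entry xs j ∸ 1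
  entry-removeColumn {[]}               _   j       = refl
  entry-removeColumn {zero ∷ xs}        _   zero    = refl
  entry-removeColumn {zero ∷ xs}        dec (suc j) = sym (ℕ.m≤n⇒m∸n≡0 {n = 1} (ℕ.≤-trans (entry≤head dec j) z≤n))
  entry-removeColumn {suc zero ∷ xs}    _   zero    = refl
  entry-removeColumn {suc zero ∷ xs}    dec (suc j) = sym (ℕ.m≤n⇒m∸n≡0 {n = 1} (entry≤head dec j))
  entry-removeColumn {suc (suc x) ∷ xs} _   zero    = refl
  entry-removeColumn {suc (suc x) ∷ xs} dec (suc j) = entry-removeColumn (Linked.tail dec) j

  removeColumn-decreasing : ∀ {xs} → Decreasing xs → Decreasing (removeColumn xs)
  removeColumn-decreasing {[]}                             _               = []
  removeColumn-decreasing {zero ∷ xs}                      _               = []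
  removeColumn-decreasing {suc zero ∷ xs}                  _               = []
  removeColumn-decreasing {suc (suc x) ∷ []}               _               = [-]
  removeColumn-decreasing {suc (suc x) ∷ zero ∷ xs}        _               = [-]
  removeColumn-decreasing {suc (suc x) ∷ suc zero ∷ xs}    _               = [-]
  removeColumn-decreasing {suc (suc x) ∷ suc (suc y) ∷ xs} (s≤s y≤x ∷ dec) = y≤x ∷ removeColumn-decreasing dec

  removeColumn-positive : ∀ xs → Positive (removeColumn xs)
  removeColumn-positive []                 = []
  removeColumn-positive (zero ∷ xs)        = []
  removeColumn-positive (suc zero ∷ xs)    = []
  removeColumn-positive (suc (suc x) ∷ xs) = s≤s z≤n ∷ removeColumn-positive xs

  length-removeColumn : ∀ xs → length (removeColumn xs) ≤ length xs
  length-removeColumn []                 = z≤n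
  length-removeColumn (zero ∷ xs)        = z≤n
  length-removeColumn (suc zero ∷ xs)    = z≤n
  length-removeColumn (suc (suc x) ∷ xs) = s≤s (length-removeColumn xs)

  sum-removeColumn : ∀ {xs} → Decreasing xs → Positive xs → sum (removeColumn xs) + length xs ≡ sum xs
  sum-removeColumn {[]}               _   _          = refl
  sum-removeColumn {suc zero ∷ xs}    dec (_ ∷ xs>0) = cong suc (sym (sum-ones dec xs>0))
    where
    sum-ones : ∀ {xs} → Decreasing (1 ∷ xs) → Positive xs → sum xs ≡ length xs
    sum-ones {[]}               _            _          = refl
    sum-ones {suc zero ∷ xs}    (_ ∷ dec)    (_ ∷ xs>0) = cong suc (sum-ones dec xs>0)
    sum-ones {suc (suc x) ∷ xs} (s≤s () ∷ _) _
  sum-removeColumn {suc (suc x) ∷ xs} dec (_ ∷ xs>0) = begin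
    suc x + sum (removeColumn xs) + suc (length xs)
      ≡⟨ ℕ.+-suc _ (length xs) ⟩
    suc (suc x + sum (removeColumn xs) + length xs)
      ≡⟨ cong suc (ℕ.+-assoc (suc x) _ _) ⟩
    suc (suc x + (sum (removeColumn xs) + length xs))
      ≡⟨ cong (λ s → suc (suc x + s)) (sum-removeColumn (Linked.tail dec) xs>0) ⟩
    suc (suc x + sum xs)
      ∎
    where open ≡-Reasoning

  entry-addColumn-< : ∀ a xs {j} → j < a → entry (addColumn a xs) j ≡ suc (entry xs j)
  entry-addColumn-< (suc a) []       {zero}  _         = refl
  entry-addColumn-< (suc a) []       {suc j} (s≤s j<a) = entry-addColumn-< a [] j<a
  entry-addColumn-< (suc a) (x ∷ xs) {zero}  _         = refl
  entry-addColumn-< (suc a) (x ∷ xs) {suc j} (s≤s j<a) = entry-addColumn-< a xs j<a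

  entry-addColumn-≥ : ∀ a xs {j} → a ≤ j → entry (addColumn a xs) j ≡ 0
  entry-addColumn-≥ zero    xs       _         = refl
  entry-addColumn-≥ (suc a) []       (s≤s a≤j) = entry-addColumn-≥ a [] a≤j
  entry-addColumn-≥ (suc a) (x ∷ xs) (s≤s a≤j) = entry-addColumn-≥ a xs a≤j

  length-addColumn : ∀ a xs → length (addColumn a xs) ≡ a
  length-addColumn zero    xs       = refl
  length-addColumn (suc a) []       = cong suc (length-addColumn a [])
  length-addColumn (suc a) (x ∷ xs) = cong suc (length-addColumn a xs)

  addColumn-positive : ∀ a xs → Positive (addColumn a xs)
  addColumn-positive zero    xs       = []
  addColumn-positive (suc a) []       = s≤s z≤n ∷ addColumn-positive a []
  addColumn-positive (suc a) (x ∷ xs) = s≤s z≤n ∷ addColumn-positive a xs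

  addColumn-decreasing : ∀ a {xs} → Decreasing xs → Decreasing (addColumn a xs)
  addColumn-decreasing zero                         _           = []
  addColumn-decreasing (suc zero)    {[]}          _           = [-]
  addColumn-decreasing (suc (suc a)) {[]}          _           = ℕ.≤-refl ∷ addColumn-decreasing (suc a) []
  addColumn-decreasing (suc zero)    {x ∷ xs}      _           = [-]
  addColumn-decreasing (suc (suc a)) {x ∷ []}      _           = s≤s z≤n ∷ addColumn-decreasing (suc a) []
  addColumn-decreasing (suc (suc a)) {x ∷ y ∷ xs} (y≤x ∷ dec) = s≤s y≤x ∷ addColumn-decreasing (suc a) dec

  sum-addColumn : ∀ a {xs} → length xs ≤ a → sum (addColumn a xs) ≡ sum xs + a
  sum-addColumn zero    {[]}     _           = refl
  sum-addColumn (suc a) {[]}     _           = cong suc (sum-addColumn a z≤n)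
  sum-addColumn (suc a) {x ∷ xs} (s≤s len≤a) = begin
    suc (x + sum (addColumn a xs)) ≡⟨ cong (λ s → suc (x + s)) (sum-addColumn a len≤a) ⟩
    suc (x + (sum xs + a))         ≡⟨ cong suc (ℕ.+-assoc x (sum xs) a) ⟨
    suc (x + sum xs + a)           ≡⟨ ℕ.+-suc (x + sum xs) a ⟨
    x + sum xs + suc a             ∎
    where open ≡-Reasoning

  removeColumn-addColumn : ∀ a {xs} → Positive xs → length xs ≤ a → removeColumn (addColumn a xs) ≡ xs
  removeColumn-addColumn zero    {[]}         _          _           = refl
  removeColumn-addColumn (suc a) {[]}         _          _           = refl
  removeColumn-addColumn (suc a) {suc x ∷ xs} (_ ∷ xs>0) (s≤s len≤a) = cong (suc x ∷_) (removeColumn-addColumn a xs>0 len≤a)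

  addColumn-removeColumn : ∀ {xs} → Decreasing xs → Positive xs → addColumn (length xs) (removeColumn xs) ≡ xs
  addColumn-removeColumn {[]}               _   _          = refl
  addColumn-removeColumn {suc zero ∷ xs}    dec (_ ∷ xs>0) = cong (1 ∷_) (ones dec xs>0)
    where
    ones : ∀ {xs} → Decreasing (1 ∷ xs) → Positive xs → addColumn (length xs) [] ≡ xs
    ones {[]}               _            _          = refl
    ones {suc zero ∷ xs}    (_ ∷ dec)    (_ ∷ xs>0) = cong (1 ∷_) (ones dec xs>0)
    ones {suc (suc x) ∷ xs} (s≤s () ∷ _) _
  addColumn-removeColumn {suc (suc x) ∷ xs} dec (_ ∷ xs>0) =
    cong (suc (suc x) ∷_) (addColumn-removeColumn (Linked.tail dec) xs>0)

module CylindricPairs where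

  open PowerSeries using (shift; shift-≥; shift-<)
  open BoxCounts using (geometric; geometric-unfold; emptyCount; boxCount; squareCount)
  open Columns
  open import Data.Nat using (_+_; _∸_; _≤_; _<_; _≥_; z≤n; s≤s; _≤?_; _≥?_; _<?_)
  open import Data.Nat.Tactic.RingSolver using (solve-∀)
  open import Data.Nat.Induction using (<-rec)
  open import Data.Nat.ListAction using (sum)
  open import Data.List using ([]; _∷_; length)
  open import Data.List.Relation.Unary.All using (all?; [])
  open import Data.List.Relation.Unary.Linked using (linked?; [])
  open import Data.Fin.Properties using (+↔⊎)
  open import Data.Product using (_×_; proj₁; proj₂)
  open import Data.Sum using (_⊎_; inj₁; inj₂)
  open import Data.Sum.Algebra using (⊎-cong)
  open import Data.Empty using (⊥; ⊥-elim; ⊥-elim-irr)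
  open import Function.Bundles using (_⇔_; mk⇔; Equivalence)
  open import Function.Related.Propositional using (module EquationalReasoning)
  open import Relation.Nullary using (¬_; yes; no; Dec; _×-dec_)
  open import Data.Vec using (lookup)
  open import Algebra.Properties.CommutativeSemigroup ℕ.+-commutativeSemigroup using (interchange)

  decreasing! : ∀ {xs} → .(Decreasing xs) → Decreasing xs
  decreasing! = recompute (linked? _≥?_ _)

  positive! : ∀ {xs} → .(Positive xs) → Positive xs
  positive! = recompute (all? (0 <?_) _)

  removeColumnₚ : Partition → Partition
  removeColumnₚ (mkPartition xs dec _) =
    mkPartition (removeColumn xs) (removeColumn-decreasing dec) (removeColumn-positive xs)

  addColumnₚ : ℕ → Partition → Partition
  addColumnₚ a (mkPartition xs dec _) =
    mkPartition (addColumn a xs) (addColumn-decreasing a dec) (addColumn-positive a xs)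

  part-removeColumnₚ : ∀ P j → part (removeColumnₚ P) j ≡ part P j ∸ 1
  part-removeColumnₚ P@(mkPartition xs dec _) j = begin
    part (removeColumnₚ P) j  ≡⟨ part≡entry (removeColumnₚ P) j ⟩
    entry (removeColumn xs) j ≡⟨ entry-removeColumn (decreasing! dec) j ⟩
    entry xs j ∸ 1            ≡⟨ cong (_∸ 1) (part≡entry P j) ⟨
    part P j ∸ 1              ∎
    where open ≡-Reasoning

  part-addColumnₚ-< : ∀ a P {j} → j < a → part (addColumnₚ a P) j ≡ suc (part P j)
  part-addColumnₚ-< a P@(mkPartition xs _ _) {j} j<a = begin
    part (addColumnₚ a P) j  ≡⟨ part≡entry (addColumnₚ a P) j ⟩
    entry (addColumn a xs) j ≡⟨ entry-addColumn-< a xs j<a ⟩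
    suc (entry xs j)         ≡⟨ cong suc (part≡entry P j) ⟨
    suc (part P j)           ∎
    where open ≡-Reasoning

  part-addColumnₚ-≥ : ∀ a P {j} → a ≤ j → part (addColumnₚ a P) j ≡ 0
  part-addColumnₚ-≥ a P@(mkPartition xs _ _) {j} a≤j =
    trans (part≡entry (addColumnₚ a P) j) (entry-addColumn-≥ a xs a≤j)

  infix 4 _≤[_]_
  _≤[_]_ : Partition → ℕ → Partition → Set
  P ≤[ k ] Q = ∀ j → part P (k + j) ≤ part Q j

  removeColumnₚ-≤[] : ∀ {P Q} k → P ≤[ k ] Q → removeColumnₚ P ≤[ k ] removeColumnₚ Q
  removeColumnₚ-≤[] {P} {Q} k P≤Q j =
    subst₂ _≤_ (sym (part-removeColumnₚ P (k + j))) (sym (part-removeColumnₚ Q j)) (ℕ.∸-monoˡ-≤ 1 (P≤Q j))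

  addColumnₚ-≤[] : ∀ {a b P Q} k → a ≤ k + b → P ≤[ k ] Q → addColumnₚ a P ≤[ k ] addColumnₚ b Q
  addColumnₚ-≤[] {a} {b} {P} {Q} k a≤k+b P≤Q j with k + j <? a
  ... | yes k+j<a =
    subst₂ _≤_ (sym (part-addColumnₚ-< a P k+j<a)) (sym (part-addColumnₚ-< b Q j<b)) (s≤s (P≤Q j))
    where j<b = ℕ.+-cancelˡ-< k _ _ (ℕ.≤-trans k+j<a a≤k+b)
  ... | no  k+j≮a = subst (_≤ _) (sym (part-addColumnₚ-≥ a P (ℕ.≮⇒≥ k+j≮a))) z≤n

  length-≤[] : ∀ {P Q} k → P ≤[ k ] Q → length (parts P) ≤ k + length (parts Q)
  length-≤[] {P@(mkPartition xs _ pos)} {Q@(mkPartition ys _ _)} k P≤Q = ℕ.≮⇒≥ λ k+∣ys∣<∣xs∣ →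
    ℕ.<-irrefl refl (begin-strict
      0                        <⟨ entry-<length (positive! pos) k+∣ys∣<∣xs∣ ⟩
      entry xs (k + length ys) ≡⟨ part≡entry P (k + length ys) ⟨
      part P (k + length ys)   ≤⟨ P≤Q (length ys) ⟩
      part Q (length ys)       ≡⟨ part≡entry Q (length ys) ⟩
      entry ys (length ys)     ≡⟨ entry-≥length ys ℕ.≤-refl ⟩
      0                        ∎)
    where open ℕ.≤-Reasoning

  record Cyl₂₀ : Set where
    constructor cyl₂₀
    field
      λ¹ λ² : Partition
      .λ²≤λ¹ : λ² ≤[ 0 ] λ¹
      .λ¹≤λ² : λ¹ ≤[ 2 ] λ²
  open Cyl₂₀

  ∣_∣₂₀ : Cyl₂₀ → ℕ
  ∣ Λ ∣₂₀ = ∣ λ¹ Λ ∣ₚ + ∣ λ² Λ ∣ₚ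

  ℓ¹ ℓ² : Cyl₂₀ → ℕ
  ℓ¹ Λ = length (parts (λ¹ Λ))
  ℓ² Λ = length (parts (λ² Λ))

  cyl₂₀-≡ : ∀ {Λ Λ′} → parts (λ¹ Λ) ≡ parts (λ¹ Λ′) → parts (λ² Λ) ≡ parts (λ² Λ′) → Λ ≡ Λ′
  cyl₂₀-≡ {cyl₂₀ (mkPartition _ _ _) (mkPartition _ _ _) _ _}
          {cyl₂₀ (mkPartition _ _ _) (mkPartition _ _ _) _ _} refl refl = refl

  removeFirstColumn : Cyl₂₀ → Cyl₂₀
  removeFirstColumn (cyl₂₀ P Q Q≤P P≤Q) =
    cyl₂₀ (removeColumnₚ P) (removeColumnₚ Q)
          (removeColumnₚ-≤[] {Q} {P} 0 Q≤P) (removeColumnₚ-≤[] {P} {Q} 2 P≤Q)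

  addFirstColumn : ∀ a b → b ≤ a → a ≤ 2 + b → Cyl₂₀ → Cyl₂₀
  addFirstColumn a b b≤a a≤2+b (cyl₂₀ P Q Q≤P P≤Q) =
    cyl₂₀ (addColumnₚ a P) (addColumnₚ b Q)
          (addColumnₚ-≤[] {P = Q} {P} 0 b≤a Q≤P) (addColumnₚ-≤[] {P = P} {Q} 2 a≤2+b P≤Q)

  ∣removeFirstColumn∣ : ∀ Λ → ∣ removeFirstColumn Λ ∣₂₀ + (ℓ¹ Λ + ℓ² Λ) ≡ ∣ Λ ∣₂₀
  ∣removeFirstColumn∣ (cyl₂₀ (mkPartition xs dx px) (mkPartition ys dy py) _ _) = begin
    sum (removeColumn xs) + sum (removeColumn ys) + (length xs + length ys)
      ≡⟨ interchange (sum (removeColumn xs)) (sum (removeColumn ys)) (length xs) (length ys) ⟩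
    (sum (removeColumn xs) + length xs) + (sum (removeColumn ys) + length ys)
      ≡⟨ cong₂ _+_ (sum-removeColumn (decreasing! dx) (positive! px))
                   (sum-removeColumn (decreasing! dy) (positive! py)) ⟩
    sum xs + sum ys
      ∎
    where open ≡-Reasoning

  ∣addFirstColumn∣ : ∀ a b b≤a a≤2+b Λ → ℓ¹ Λ ≤ a → ℓ² Λ ≤ b →
                     ∣ addFirstColumn a b b≤a a≤2+b Λ ∣₂₀ ≡ ∣ Λ ∣₂₀ + (a + b)
  ∣addFirstColumn∣ a b _ _ (cyl₂₀ (mkPartition xs _ _) (mkPartition ys _ _) _ _) ℓ¹≤a ℓ²≤b = begin
    sum (addColumn a xs) + sum (addColumn b ys) ≡⟨ cong₂ _+_ (sum-addColumn a ℓ¹≤a) (sum-addColumn b ℓ²≤b) ⟩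
    (sum xs + a) + (sum ys + b)                 ≡⟨ interchange (sum xs) (sum ys) a b ⟨
    sum xs + sum ys + (a + b)                   ∎
    where open ≡-Reasoning

  ℓ-removeFirstColumn : ∀ Λ → ℓ¹ (removeFirstColumn Λ) ≤ ℓ¹ Λ × ℓ² (removeFirstColumn Λ) ≤ ℓ² Λ
  ℓ-removeFirstColumn (cyl₂₀ (mkPartition xs _ _) (mkPartition ys _ _) _ _) =
    length-removeColumn xs , length-removeColumn ys

  ℓ-addFirstColumn : ∀ a b b≤a a≤2+b Λ → let Λ′ = addFirstColumn a b b≤a a≤2+b Λ in ℓ¹ Λ′ ≡ a × ℓ² Λ′ ≡ b
  ℓ-addFirstColumn a b _ _ (cyl₂₀ (mkPartition xs _ _) (mkPartition ys _ _) _ _) =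
    length-addColumn a xs , length-addColumn b ys

  removeFirstColumn-addFirstColumn : ∀ a b b≤a a≤2+b Λ → .(ℓ¹ Λ ≤ a) → .(ℓ² Λ ≤ b) →
                                     removeFirstColumn (addFirstColumn a b b≤a a≤2+b Λ) ≡ Λ
  removeFirstColumn-addFirstColumn a b _ _ (cyl₂₀ (mkPartition xs _ px) (mkPartition ys _ py) _ _) ℓ¹≤a ℓ²≤b =
    cyl₂₀-≡ (removeColumn-addColumn a (positive! px) (recompute (_ ≤? a) ℓ¹≤a))
            (removeColumn-addColumn b (positive! py) (recompute (_ ≤? b) ℓ²≤b))

  addFirstColumn-removeFirstColumn : ∀ a b b≤a a≤2+b Λ → .(ℓ¹ Λ ≡ a) → .(ℓ² Λ ≡ b) →
                                     addFirstColumn a b b≤a a≤2+b (removeFirstColumn Λ) ≡ Λ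
  addFirstColumn-removeFirstColumn a b _ _ (cyl₂₀ (mkPartition xs dx px) (mkPartition ys dy py) _ _) ℓ¹≡a ℓ²≡b =
    cyl₂₀-≡ (trans (cong (λ k → addColumn k (removeColumn xs)) (recompute (a ℕ.≟ _) (sym ℓ¹≡a)))
                   (addColumn-removeColumn (decreasing! dx) (positive! px)))
            (trans (cong (λ k → addColumn k (removeColumn ys)) (recompute (b ℕ.≟ _) (sym ℓ²≡b)))
                   (addColumn-removeColumn (decreasing! dy) (positive! py)))

  ℓ≤∣∣ : ∀ Λ → ℓ¹ Λ + ℓ² Λ ≤ ∣ Λ ∣₂₀
  ℓ≤∣∣ (cyl₂₀ (mkPartition _ _ px) (mkPartition _ _ py) _ _) =
    ℕ.+-mono-≤ (length≤sum (positive! px)) (length≤sum (positive! py))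

  ℓ-valid : ∀ Λ → ℓ² Λ ≤ ℓ¹ Λ × ℓ¹ Λ ≤ 2 + ℓ² Λ
  ℓ-valid (cyl₂₀ P Q Q≤P P≤Q) =
    recompute (_ ≤? _) (length-≤[] {Q} {P} 0 Q≤P) , recompute (_ ≤? _) (length-≤[] {P} {Q} 2 P≤Q)

  Region : Set₁
  Region = ℕ → ℕ → Set

  Box At : ℕ → ℕ → Region
  Box A B a b = a ≤ A × b ≤ B
  At  A B a b = a ≡ A × b ≡ B

  infixl 6 _∖⟨_,_⟩
  _∖⟨_,_⟩ : Region → ℕ → ℕ → Region
  (R ∖⟨ A , B ⟩) a b = R a b × ¬ At A B a b

  infix 4 _≐_
  _≐_ : Region → Region → Set
  R ≐ S = ∀ {a b} → b ≤ a → a ≤ 2 + b → R a b ⇔ S a b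

  record CylIn (R : Region) (n : ℕ) : Set where
    constructor cylIn
    field
      cyl     : Cyl₂₀
      .size≡  : ∣ cyl ∣₂₀ ≡ n
      .shape∈ : R (ℓ¹ cyl) (ℓ² cyl)

  cylIn-≡ : ∀ {R n} {x y : CylIn R n} → CylIn.cyl x ≡ CylIn.cyl y → x ≡ y
  cylIn-≡ {x = cylIn _ _ _} {cylIn _ _ _} refl = refl

  CylIn-cong : ∀ {R S n} → R ≐ S → CylIn R n ↔ CylIn S n
  CylIn-cong {R} {S} {n} R≐S = mk↔ₛ′ to from (λ { (cylIn _ _ _) → refl }) (λ { (cylIn _ _ _) → refl })
    where
    ≐-at : ∀ Λ → R (ℓ¹ Λ) (ℓ² Λ) ⇔ S (ℓ¹ Λ) (ℓ² Λ)
    ≐-at Λ = R≐S (proj₁ (ℓ-valid Λ)) (proj₂ (ℓ-valid Λ))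
    to : CylIn R n → CylIn S n
    to (cylIn Λ s r) = cylIn Λ s (Equivalence.to (≐-at Λ) r)
    from : CylIn S n → CylIn R n
    from (cylIn Λ s r) = cylIn Λ s (Equivalence.from (≐-at Λ) r)

  removeCorner : ∀ {R n} A B → R A B → CylIn R n ↔ (CylIn (R ∖⟨ A , B ⟩) n ⊎ CylIn (At A B) n)
  removeCorner {R} {n} A B rAB = mk↔ₛ′ to from to∘from from∘to
    where
    at? : ∀ Λ → Dec (At A B (ℓ¹ Λ) (ℓ² Λ))
    at? Λ = (ℓ¹ Λ ℕ.≟ A) ×-dec (ℓ² Λ ℕ.≟ B)
    classify : ∀ Λ → .(∣ Λ ∣₂₀ ≡ n) → .(R (ℓ¹ Λ) (ℓ² Λ)) → Dec (At A B (ℓ¹ Λ) (ℓ² Λ)) →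
               CylIn (R ∖⟨ A , B ⟩) n ⊎ CylIn (At A B) n
    classify Λ s r (yes at) = inj₂ (cylIn Λ s at)
    classify Λ s r (no ¬at) = inj₁ (cylIn Λ s (r , ¬at))
    to : CylIn R n → CylIn (R ∖⟨ A , B ⟩) n ⊎ CylIn (At A B) n
    to (cylIn Λ s r) = classify Λ s r (at? Λ)
    from : CylIn (R ∖⟨ A , B ⟩) n ⊎ CylIn (At A B) n → CylIn R n
    from (inj₁ (cylIn Λ s r))  = cylIn Λ s (proj₁ r)
    from (inj₂ (cylIn Λ s at)) = cylIn Λ s (subst₂ R (sym (proj₁ at)) (sym (proj₂ at)) rAB)
    to∘from : ∀ y → to (from y) ≡ y
    to∘from (inj₁ (cylIn Λ s r)) with at? Λ
    ... | yes at = ⊥-elim-irr (proj₂ r at)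
    ... | no _   = refl
    to∘from (inj₂ (cylIn Λ s at)) with at? Λ
    ... | yes _  = refl
    ... | no ¬at = ⊥-elim-irr (¬at at)
    from∘to : ∀ x → from (to x) ≡ x
    from∘to (cylIn Λ s r) with at? Λ
    ... | yes _ = refl
    ... | no _  = refl

  removeFirstColumn-↔ : ∀ {A B n} → B ≤ A → A ≤ 2 + B → A + B ≤ n →
                        CylIn (At A B) n ↔ CylIn (Box A B) (n ∸ (A + B))
  removeFirstColumn-↔ {A} {B} {n} B≤A A≤2+B A+B≤n = mk↔ₛ′ to from to∘from from∘to
    where
    add = addFirstColumn A B B≤A A≤2+B
    to : CylIn (At A B) n → CylIn (Box A B) (n ∸ (A + B))
    to (cylIn Λ s at) = cylIn (removeFirstColumn Λ) (size s at) (shape at)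
      where
      size : ∣ Λ ∣₂₀ ≡ n → At A B (ℓ¹ Λ) (ℓ² Λ) → ∣ removeFirstColumn Λ ∣₂₀ ≡ n ∸ (A + B)
      size refl (refl , refl) =
        sym (trans (cong (_∸ (A + B)) (sym (∣removeFirstColumn∣ Λ))) (ℕ.m+n∸n≡m _ (A + B)))
      shape : At A B (ℓ¹ Λ) (ℓ² Λ) → Box A B (ℓ¹ (removeFirstColumn Λ)) (ℓ² (removeFirstColumn Λ))
      shape (refl , refl) = ℓ-removeFirstColumn Λ
    from : CylIn (Box A B) (n ∸ (A + B)) → CylIn (At A B) n
    from (cylIn Λ s box) = cylIn (add Λ) (size s box) (ℓ-addFirstColumn A B B≤A A≤2+B Λ)
      where
      size : ∣ Λ ∣₂₀ ≡ n ∸ (A + B) → Box A B (ℓ¹ Λ) (ℓ² Λ) → ∣ add Λ ∣₂₀ ≡ n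
      size ∣Λ∣≡ (ℓ¹≤A , ℓ²≤B) = begin
        ∣ add Λ ∣₂₀           ≡⟨ ∣addFirstColumn∣ A B B≤A A≤2+B Λ ℓ¹≤A ℓ²≤B ⟩
        ∣ Λ ∣₂₀ + (A + B)     ≡⟨ cong (_+ (A + B)) ∣Λ∣≡ ⟩
        n ∸ (A + B) + (A + B) ≡⟨ ℕ.m∸n+n≡m A+B≤n ⟩
        n                     ∎
        where open ≡-Reasoning
    to∘from : ∀ y → to (from y) ≡ y
    to∘from (cylIn Λ _ box) = cylIn-≡ (removeFirstColumn-addFirstColumn A B B≤A A≤2+B Λ (proj₁ box) (proj₂ box))
    from∘to : ∀ x → from (to x) ≡ x
    from∘to (cylIn Λ _ at) = cylIn-≡ (addFirstColumn-removeFirstColumn A B B≤A A≤2+B Λ (proj₁ at) (proj₂ at))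

  At-empty : ∀ {A B n} → n < A + B → ¬ CylIn (At A B) n
  At-empty {A} {B} n<A+B (cylIn Λ s at) = ⊥-elim-irr (contradiction s at)
    where
    contradiction : ∣ Λ ∣₂₀ ≡ _ → At A B (ℓ¹ Λ) (ℓ² Λ) → ⊥
    contradiction refl (refl , refl) = ℕ.<⇒≱ n<A+B (ℓ≤∣∣ Λ)

  0↔empty : ∀ {X : Set} → ¬ X → Fin 0 ↔ X
  0↔empty ¬x = mk↔ₛ′ (λ ()) (⊥-elim ∘ ¬x) (⊥-elim ∘ ¬x) (λ ())

  shift-↔At : ∀ {A B e c n} → A + B ≡ e → B ≤ A → A ≤ 2 + B →
             (e ≤ n → Fin (c (n ∸ e)) ↔ CylIn (Box A B) (n ∸ e)) → Fin (shift e c n) ↔ CylIn (At A B) n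
  shift-↔At {A} {B} {e} {c} {n} refl B≤A A≤2+B count with e ≤? n
  ... | yes e≤n = begin
    Fin (shift e c n)          ≡⟨ cong Fin (shift-≥ c e≤n) ⟩
    Fin (c (n ∸ e))            ↔⟨ count e≤n ⟩
    CylIn (Box A B) (n ∸ e)    ↔⟨ removeFirstColumn-↔ B≤A A≤2+B e≤n ⟨
    CylIn (At A B) n           ∎
    where open EquationalReasoning
  ... | no  e≰n = begin
    Fin (shift e c n)          ≡⟨ cong Fin (shift-< c (ℕ.≰⇒> e≰n)) ⟩
    Fin 0                      ↔⟨ 0↔empty (At-empty (ℕ.≰⇒> e≰n)) ⟩
    CylIn (At A B) n           ∎
    where open EquationalReasoning

  geometric-↔ : ∀ {A B u g} → A + B ≡ suc u → B ≤ A → A ≤ 2 + B →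
                (∀ n → Fin (g n) ↔ CylIn (Box A B ∖⟨ A , B ⟩) n) →
                ∀ n → Fin (geometric u g n) ↔ CylIn (Box A B) n
  geometric-↔ {A} {B} {u} {g} A+B≡1+u B≤A A≤2+B count = <-rec _ step
    where
    step : ∀ n → (∀ {m} → m < n → Fin (geometric u g m) ↔ CylIn (Box A B) m) →
           Fin (geometric u g n) ↔ CylIn (Box A B) n
    step n rec = begin
      Fin (geometric u g n)
        ≡⟨ cong Fin (geometric-unfold u g n) ⟩
      Fin (g n + shift (suc u) (geometric u g) n)
        ↔⟨ +↔⊎ ⟩
      (Fin (g n) ⊎ Fin (shift (suc u) (geometric u g) n))
        ↔⟨ ⊎-cong (count n) (shift-↔At A+B≡1+u B≤A A≤2+B (rec ∘ below)) ⟩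
      (CylIn (Box A B ∖⟨ A , B ⟩) n ⊎ CylIn (At A B) n)
        ↔⟨ removeCorner A B (ℕ.≤-refl , ℕ.≤-refl) ⟨
      CylIn (Box A B) n
        ∎
      where
      open EquationalReasoning
      below : suc u ≤ n → n ∸ suc u < n
      below 1+u≤n = ℕ.∸-monoʳ-< (s≤s z≤n) 1+u≤n

  ∅₂₀ : Cyl₂₀
  ∅₂₀ = cyl₂₀ ∅ ∅ (λ _ → z≤n) (λ _ → z≤n)
    where ∅ = mkPartition [] [] []

  Box₀₀-∅ : ∀ {n} (x : CylIn (Box 0 0) n) → CylIn.cyl x ≡ ∅₂₀ × n ≡ 0
  Box₀₀-∅ (cylIn (cyl₂₀ (mkPartition [] _ _) (mkPartition [] _ _) _ _) s _) =
    cyl₂₀-≡ refl refl , recompute (_ ℕ.≟ 0) (sym s)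
  Box₀₀-∅ (cylIn (cyl₂₀ (mkPartition (_ ∷ _) _ _) _ _ _) _ box) =
    ⊥-elim-irr (ℕ.1+n≢0 (ℕ.n≤0⇒n≡0 (proj₁ box)))
  Box₀₀-∅ (cylIn (cyl₂₀ (mkPartition [] _ _) (mkPartition (_ ∷ _) _ _) _ _) _ box) =
    ⊥-elim-irr (ℕ.1+n≢0 (ℕ.n≤0⇒n≡0 (proj₂ box)))

  emptyCount-↔ : ∀ n → Fin (emptyCount n) ↔ CylIn (Box 0 0) n
  emptyCount-↔ zero    = mk↔ₛ′ (λ _ → cylIn ∅₂₀ refl (z≤n , z≤n)) (λ _ → Fin.zero)
                               (λ x → cylIn-≡ (sym (proj₁ (Box₀₀-∅ x)))) (λ { Fin.zero → refl ; (Fin.suc ()) })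
  emptyCount-↔ (suc n) = 0↔empty (λ x → ℕ.1+n≢0 (proj₂ (Box₀₀-∅ x)))

  column-corner : ∀ {A B} → B ≤ ℕ.pred A → Box (suc A) B ∖⟨ suc A , B ⟩ ≐ Box A B
  column-corner {A} {B} B≤A-1 {a} {b} b≤a a≤2+b = mk⇔ to from
    where
    to : (Box (suc A) B ∖⟨ suc A , B ⟩) a b → Box A B a b
    to ((a≤1+A , b≤B) , ¬corner) with a ℕ.≟ suc A
    ... | yes refl  = ⊥-elim (¬corner (refl , ℕ.≤-antisym b≤B (ℕ.≤-trans B≤A-1 (ℕ.pred-mono-≤ (ℕ.≤-pred a≤2+b)))))
    ... | no  a≢1+A = ℕ.≤-pred (ℕ.≤∧≢⇒< a≤1+A a≢1+A) , b≤B
    from : Box A B a b → (Box (suc A) B ∖⟨ suc A , B ⟩) a b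
    from (a≤A , b≤B) = (ℕ.m≤n⇒m≤1+n a≤A , b≤B) , λ (a≡1+A , _) → ℕ.<⇒≱ (ℕ.≤-reflexive (sym a≡1+A)) a≤A

  row-corner : ∀ {A B} → A ≤ suc B → Box A (suc B) ∖⟨ A , suc B ⟩ ≐ Box A B
  row-corner {A} {B} A≤1+B {a} {b} b≤a a≤2+b = mk⇔ to from
    where
    to : (Box A (suc B) ∖⟨ A , suc B ⟩) a b → Box A B a b
    to ((a≤A , b≤1+B) , ¬corner) with b ℕ.≟ suc B
    ... | yes refl  = ⊥-elim (¬corner (ℕ.≤-antisym a≤A (ℕ.≤-trans A≤1+B b≤a) , refl))
    ... | no  b≢1+B = a≤A , ℕ.≤-pred (ℕ.≤∧≢⇒< b≤1+B b≢1+B)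
    from : Box A B a b → (Box A (suc B) ∖⟨ A , suc B ⟩) a b
    from (a≤A , b≤B) = (a≤A , ℕ.m≤n⇒m≤1+n b≤B) , λ (_ , b≡1+B) → ℕ.<⇒≱ (ℕ.≤-reflexive (sym b≡1+B)) b≤B

  column-corners : ∀ m → (Box (2 + m) (suc m) ∖⟨ 2 + m , suc m ⟩) ∖⟨ 2 + m , m ⟩ ≐ Box (suc m) (suc m)
  column-corners m {a} {b} b≤a a≤2+b = mk⇔ to from
    where
    to : ((Box (2 + m) (suc m) ∖⟨ 2 + m , suc m ⟩) ∖⟨ 2 + m , m ⟩) a b → Box (suc m) (suc m) a b
    to (((a≤2+m , b≤1+m) , ¬corner₁) , ¬corner₂) with a ℕ.≟ 2 + m | b ℕ.≟ suc m
    ... | yes refl | yes refl = ⊥-elim (¬corner₁ (refl , refl))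
    ... | yes refl | no b≢1+m = ⊥-elim (¬corner₂ (refl , ℕ.≤-antisym b≤m (ℕ.≤-pred (ℕ.≤-pred a≤2+b))))
      where b≤m = ℕ.≤-pred (ℕ.≤∧≢⇒< b≤1+m b≢1+m)
    ... | no a≢2+m | _        = ℕ.≤-pred (ℕ.≤∧≢⇒< a≤2+m a≢2+m) , b≤1+m
    from : Box (suc m) (suc m) a b → ((Box (2 + m) (suc m) ∖⟨ 2 + m , suc m ⟩) ∖⟨ 2 + m , m ⟩) a b
    from (a≤1+m , b≤1+m) = ((ℕ.m≤n⇒m≤1+n a≤1+m , b≤1+m) , not-column) , not-column
      where
      not-column : ∀ {c} → ¬ At (2 + m) c a b
      not-column (a≡2+m , _) = ℕ.<⇒≱ (ℕ.≤-reflexive (sym a≡2+m)) a≤1+m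

  square-weight : ∀ m → suc m + suc m ≡ 2 + m ℕ.* 2
  square-weight = solve-∀

  square-weight′ : ∀ m → 2 + m + m ≡ 2 + m ℕ.* 2
  square-weight′ = solve-∀

  box-weight : ∀ m → 2 + m + suc m ≡ 3 + m ℕ.* 2
  box-weight = solve-∀

  mutual
    boxCount-↔ : ∀ m n → Fin (boxCount m n) ↔ CylIn (Box (suc m) m) n
    boxCount-↔ zero    = geometric-↔ refl z≤n (s≤s z≤n)
      (λ n → ↔-trans (emptyCount-↔ n) (↔-sym (CylIn-cong (column-corner z≤n))))
    boxCount-↔ (suc m) = geometric-↔ (box-weight m) (ℕ.n≤1+n _) (ℕ.n≤1+n _) count
      where
      R = Box (2 + m) (suc m) ∖⟨ 2 + m , suc m ⟩
      e = 2 + m ℕ.* 2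
      count : ∀ n → Fin (squareCount m n + shift e (squareCount m) n) ↔ CylIn R n
      count n = begin
        Fin (squareCount m n + shift e (squareCount m) n)
          ↔⟨ +↔⊎ ⟩
        (Fin (squareCount m n) ⊎ Fin (shift e (squareCount m) n))
          ↔⟨ ⊎-cong (↔-trans (squareCount-↔ m n) (↔-sym (CylIn-cong (column-corners m))))
                    (shift-↔At (square-weight′ m) (ℕ.m≤n+m m 2) ℕ.≤-refl (λ _ → squareCount-↔′ m _)) ⟩
        (CylIn (R ∖⟨ 2 + m , m ⟩) n ⊎ CylIn (At (2 + m) m) n)
          ↔⟨ removeCorner (2 + m) m ((ℕ.≤-refl , ℕ.n≤1+n m) , λ (_ , m≡1+m) → ℕ.<⇒≢ (ℕ.n<1+n m) m≡1+m) ⟨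
        CylIn R n
          ∎
        where open EquationalReasoning

    squareCount-↔ : ∀ m n → Fin (squareCount m n) ↔ CylIn (Box (suc m) (suc m)) n
    squareCount-↔ m = geometric-↔ (square-weight m) ℕ.≤-refl (ℕ.m≤n+m (suc m) 2)
      (λ n → ↔-trans (boxCount-↔ m n) (↔-sym (CylIn-cong (row-corner ℕ.≤-refl))))

    squareCount-↔′ : ∀ m n → Fin (squareCount m n) ↔ CylIn (Box (2 + m) m) n
    squareCount-↔′ m = geometric-↔ (square-weight′ m) (ℕ.m≤n+m m 2) ℕ.≤-refl
      (λ n → ↔-trans (boxCount-↔ m n) (↔-sym (CylIn-cong (column-corner {suc m} ℕ.≤-refl))))

  CylOfSize₂₀ : ℕ → Set
  CylOfSize₂₀ = CylOfSize 2 (2 ∷ 0 ∷ [])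

  Cylindric₂₀ : Partition → Partition → Set
  Cylindric₂₀ P Q = ∀ (i : Fin 2) j →
    part (lookup (P ∷ Q ∷ []) i) j ≥ part (lookup (P ∷ Q ∷ []) (next i)) (j + lookup (2 ∷ 0 ∷ []) (next i))

  cylindric₂₀⇒≤[] : ∀ {P Q} → Cylindric₂₀ P Q → Q ≤[ 0 ] P × P ≤[ 2 ] Q
  cylindric₂₀⇒≤[] {P} {Q} c =
      (λ j → subst (λ k → part Q k ≤ part P j) (ℕ.+-identityʳ j) (c Fin.zero j))
    , (λ j → subst (λ k → part P k ≤ part Q j) (ℕ.+-comm j 2) (c (Fin.suc Fin.zero) j))

  ≤[]⇒cylindric₂₀ : ∀ {P Q} → Q ≤[ 0 ] P → P ≤[ 2 ] Q → Cylindric₂₀ P Q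
  ≤[]⇒cylindric₂₀ {P} {Q} Q≤P _   Fin.zero           j =
    subst (λ k → part Q k ≤ part P j) (sym (ℕ.+-identityʳ j)) (Q≤P j)
  ≤[]⇒cylindric₂₀ {P} {Q} _   P≤Q (Fin.suc Fin.zero) j =
    subst (λ k → part P k ≤ part Q j) (ℕ.+-comm 2 j) (P≤Q j)

  CylOfSize↔Box : ∀ {m n} → n ≤ m → CylOfSize₂₀ n ↔ CylIn (Box (suc m) m) n
  CylOfSize↔Box {m} {n} n≤m = mk↔ₛ′ to from (λ { (cylIn (cyl₂₀ _ _ _ _) _ _) → refl }) from∘to
    where
    ∣P∣+∣Q∣+0 : ∀ P Q → ∣ P ∣ₚ + (∣ Q ∣ₚ + 0) ≡ ∣ P ∣ₚ + ∣ Q ∣ₚ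
    ∣P∣+∣Q∣+0 P Q = cong (_+_ ∣ P ∣ₚ) (ℕ.+-identityʳ ∣ Q ∣ₚ)
    fits : ∀ Λ → ∣ Λ ∣₂₀ ≡ n → Box (suc m) m (ℓ¹ Λ) (ℓ² Λ)
    fits Λ refl = ℕ.m≤n⇒m≤1+n (ℕ.≤-trans (ℕ.m+n≤o⇒m≤o (ℓ¹ Λ) (ℓ≤∣∣ Λ)) n≤m)
                , ℕ.≤-trans (ℕ.m+n≤o⇒n≤o (ℓ¹ Λ) (ℓ≤∣∣ Λ)) n≤m
    to : CylOfSize₂₀ n → CylIn (Box (suc m) m) n
    to (mkCyl (P ∷ Q ∷ []) c , ∣Λ∣≡n) = cylIn Λ ∣Λ∣₂₀≡n (fits Λ ∣Λ∣₂₀≡n)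
      where
      Λ = cyl₂₀ P Q (proj₁ (cylindric₂₀⇒≤[] c)) (proj₂ (cylindric₂₀⇒≤[] c))
      ∣Λ∣₂₀≡n = trans (sym (∣P∣+∣Q∣+0 P Q)) ∣Λ∣≡n
    from : CylIn (Box (suc m) m) n → CylOfSize₂₀ n
    from (cylIn (cyl₂₀ P Q Q≤P P≤Q) ∣Λ∣≡n _) =
      mkCyl (P ∷ Q ∷ []) (≤[]⇒cylindric₂₀ Q≤P P≤Q) , recompute (_ ℕ.≟ n) (trans (∣P∣+∣Q∣+0 P Q) ∣Λ∣≡n)
    from∘to : ∀ x → from (to x) ≡ x
    from∘to (mkCyl (P ∷ Q ∷ []) c , e) = cong (mkCyl (P ∷ Q ∷ []) c ,_) (ℕ.≡-irrelevant _ e)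

open PowerSeries
open BoxCounts
open CylindricPairs
open import Data.Nat using (_≤_; s≤s)
open import Data.Fin.Permutation using (↔⇒≡)

cylindricCount : ℕ → ℕ
cylindricCount n = boxCount n n

cylindricCount-↔ : ∀ n → Fin (cylindricCount n) ↔ CylOfSize₂₀ n
cylindricCount-↔ n = ↔-trans (boxCount-↔ n n) (↔-sym (CylOfSize↔Box ℕ.≤-refl))

boxCount-stable : ∀ {i m} → i ≤ m → boxCount m i ≡ cylindricCount i
boxCount-stable {i} {m} i≤m =
  ↔⇒≡ (↔-trans (boxCount-↔ m i) (↔-trans (↔-sym (CylOfSize↔Box i≤m)) (↔-sym (cylindricCount-↔ i))))

cylindricCount-⊗-poch : (+_ ∘ cylindricCount) ⊗ pochInf q q ≗ pochInf (⊖ (q ^^ 2)) (q ^^ 2)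
cylindricCount-⊗-poch n = begin
  ((+_ ∘ cylindricCount) ⊗ pochInf q q) n
    ≡⟨ ⊗-cong-≤ n (λ i≤n → cong +_ (sym (boxCount-stable i≤n))) (λ j≤n → sym (poch-q-stable (1+j≤′1+2n j≤n))) ⟩
  ((+_ ∘ boxCount n) ⊗ poch-q (suc (n ℕ.* 2))) n
    ≡⟨ boxCount-⊗-poch-q n n ⟩
  poch-q² n n
    ≡⟨ pochInf-q²-stable n ⟨
  pochInf (⊖ (q ^^ 2)) (q ^^ 2) n
    ∎
  where
  open ≡-Reasoning
  1+j≤′1+2n : ∀ {j} → j ≤ n → suc j ℕ.≤′ suc (n ℕ.* 2)
  1+j≤′1+2n j≤n = ℕ.≤⇒≤′ (s≤s (ℕ.≤-trans j≤n (ℕ.m≤m*n n 2)))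

generating-function : ∀ n → (pochInf (⊖ (q ^^ 2)) (q ^^ 2) ⊘ pochInf q q) n ≡ + cylindricCount n
generating-function = begin
  pochInf (⊖ (q ^^ 2)) (q ^^ 2) ⊗ inv Q∞ ≈⟨ ⊗-congʳ (inv Q∞) cylindricCount-⊗-poch ⟨
  (C ⊗ Q∞) ⊗ inv Q∞                      ≈⟨ ⊗-assoc C Q∞ (inv Q∞) ⟩
  C ⊗ (Q∞ ⊗ inv Q∞)                      ≈⟨ ⊗-congˡ C (⊗-inverseʳ Q∞ refl) ⟩
  C ⊗ 𝟙                                  ≈⟨ ⊗-identityʳ C ⟩
  C                                      ∎
  where
  open import Relation.Binary.Reasoning.Setoid (ℕ →-setoid ℤ)
  C  = +_ ∘ cylindricCount
  Q∞ = pochInf q q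

theorem3p2 : GenFunEq 2 (2 ∷ 0 ∷ []) (pochInf (⊖ (q ^^ 2)) (q ^^ 2) ⊘ pochInf q q)
theorem3p2 n = cylindricCount n , generating-function n , cylindricCount-↔ n
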